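{- Let $(F_n)_{n\geq 1}$ be the Fibonacci sequence defined by $F_1=0$, $F_2=1$, and $F_{n+1}=F_n+F_{n-1}$ for $n\geq 2$. Then $F_n^2+1$ is composite for every integer $n>4$. -}

module Defs where

open import Data.Nat using (ℕ; zero; suc; _+_)

-- Fibonacci sequence with the paper's indexing: F 1 = 0, F 2 = 1,
-- F (n+1) = F n + F (n-1) for n ≥ 2.  The value F 0 = 1 is chosen so the
-- recurrence also yields F 2 = F 1 + F 0; it is irrelevant to the statement.
F : ℕ → ℕ
F zero = 1
F (suc zero) = 0
F (suc (suc n)) = F (suc n) + F n

-- Cassini's identity F(m) F(m+2) − F(m+1)² = ±1 alternates in sign.  When
-- the sign is +, it factors F(m+1)² + 1 directly as F(m) F(m+2); when it is −,
-- combining it with the previous Cassini identity gives the Catalan identity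
-- F(m+1)² + 1 = F(m−1) F(m+3).  For indices n > 4 both factors are at least
-- F 4 = 2, so F(n)² + 1 is composite.
module Submission where

open import Defs
open import Data.List.Base using ([]; _∷_)
open import Data.Nat.Base using (ℕ; zero; suc; 2+; _+_; _*_; _≤_; _<_; _>_; s≤s; z≤n)
open import Data.Nat.Divisibility using (m∣m*n)
open import Data.Nat.Primality using (Composite; composite)
open import Data.Nat.Properties using (m<m*n; m≤m+n; ≤-trans)
open import Data.Nat.Tactic.RingSolver using (solve)
open import Relation.Binary.PropositionalEquality using (_≡_; refl; sym; cong; subst; module ≡-Reasoning)

composite-* : ∀ {m n} → 1 < m → 1 < n → Composite (m * n)
composite-* {1}            (s≤s ()) _
composite-* {m@(2+ _)} {n} _ 1<n = composite (m<m*n m n 1<n) (m∣m*n n)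

module _ (a b : ℕ) where
  open ≡-Reasoning

  -- Subtraction-free forms of: for consecutive terms a, b, b + a of a
  -- Fibonacci-like sequence, b (2b + a) − (b + a)² = −(a (b + a) − b²).
  cassini-flip⁺ : a * (b + a) ≡ b * b + 1 → b * ((b + a) + b) + 1 ≡ (b + a) * (b + a)
  cassini-flip⁺ h = begin
    b * ((b + a) + b) + 1      ≡⟨ solve (a ∷ b ∷ []) ⟩
    (b * b + 1) + b * (b + a)  ≡⟨ cong (_+ b * (b + a)) (sym h) ⟩
    a * (b + a) + b * (b + a)  ≡⟨ solve (a ∷ b ∷ []) ⟩
    (b + a) * (b + a)          ∎

  cassini-flip⁻ : a * (b + a) + 1 ≡ b * b → b * ((b + a) + b) ≡ (b + a) * (b + a) + 1
  cassini-flip⁻ h = begin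
    b * ((b + a) + b)                ≡⟨ solve (a ∷ b ∷ []) ⟩
    b * b + b * (b + a)              ≡⟨ cong (_+ b * (b + a)) (sym h) ⟩
    (a * (b + a) + 1) + b * (b + a)  ≡⟨ solve (a ∷ b ∷ []) ⟩
    (b + a) * (b + a) + 1            ∎

  catalan₂ : a * (b + a) ≡ b * b + 1 → (b + a) * (b + a) + 1 ≡ a * (((b + a) + b) + (b + a))
  catalan₂ h = begin
    (b + a) * (b + a) + 1              ≡⟨ solve (a ∷ b ∷ []) ⟩
    (a * a + 2 * a * b) + (b * b + 1)  ≡⟨ cong ((a * a + 2 * a * b) +_) (sym h) ⟩
    (a * a + 2 * a * b) + a * (b + a)  ≡⟨ solve (a ∷ b ∷ []) ⟩
    a * (((b + a) + b) + (b + a))      ∎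

double : ℕ → ℕ
double zero    = zero
double (suc k) = 2+ (double k)

data Parity : ℕ → Set where
  even : ∀ k → Parity (double k)
  odd  : ∀ k → Parity (suc (double k))

parity : ∀ n → Parity n
parity zero = even zero
parity (suc zero) = odd zero
parity (2+ n) with parity n
... | even k = even (suc k)
... | odd k  = odd (suc k)

F-cassini-even : ∀ k → F (double k) * F (2 + double k) ≡ F (1 + double k) * F (1 + double k) + 1
F-cassini-odd  : ∀ k → F (1 + double k) * F (3 + double k) + 1 ≡ F (2 + double k) * F (2 + double k)

-- The base case holds thanks to the convention F 0 = 1; it is only used for k ≥ 2.
F-cassini-even zero    = refl
F-cassini-even (suc k) = cassini-flip⁻ (F (1 + double k)) (F (2 + double k)) (F-cassini-odd k)
F-cassini-odd k        = cassini-flip⁺ (F (double k)) (F (1 + double k)) (F-cassini-even k)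

F-catalan-even : ∀ k → F (2 + double k) * F (2 + double k) + 1 ≡ F (double k) * F (4 + double k)
F-catalan-even k = catalan₂ (F (double k)) (F (1 + double k)) (F-cassini-even k)

F[4+n]≥2 : ∀ n → 2 ≤ F (4 + n)
F[4+n]≥2 zero    = s≤s (s≤s z≤n)
F[4+n]≥2 (suc n) = ≤-trans (F[4+n]≥2 n) (m≤m+n _ _)

corollary10 : (n : ℕ) → n > 4 → Composite (F n * F n + 1)
-- Here n = 5 + m, which is 1 + double (2 + k) or 2 + double (2 + k).
corollary10 _ (s≤s (s≤s (s≤s (s≤s (s≤s {n = m} z≤n))))) with parity m
... | even k = subst Composite (F-cassini-even (2 + k))
                 (composite-* (F[4+n]≥2 (double k)) (F[4+n]≥2 (2 + double k)))
... | odd k  = subst Composite (sym (F-catalan-even (2 + k)))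
                 (composite-* (F[4+n]≥2 (double k)) (F[4+n]≥2 (4 + double k)))
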